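{- Let $a(n)$ be the number of $1$'s in $b_1 b_2 \cdots b_n$. Then the limit $\alpha = \lim_{n \to \infty} a(n)/n$ exists and equals $2 - 2\sum_{i \geq 1} b_i 2^{ -i}$.
   Context: Define finite binary words $B_i$ by $B_1 = 101$ and $B_{i+1} = B_i C_i$ for $i \geq 1$, where $C_i$ is the word obtained from $B_i$ by removing its first $i$ symbols. Since each $B_i$ is a prefix of $B_{i+1}$, there is a unique infinite binary word $\mathbf{b} = b_1 b_2 b_3 \cdots$ (with $b_i \in \{0,1\}$) of which every $B_i$ is a prefix. -}

module Defs where

open import Data.Bool using (Bool; true; false; if_then_else_)
open import Data.List using (List; []; _∷_; _++_; drop)
open import Data.Nat using (ℕ; zero; suc)
open import Data.Integer using (+_)
open import Data.Rational using (ℚ; 0ℚ; 1ℚ; ½; _+_; _*_; _/_)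

-- B n is the paper's B_n for n ≥ 1 (true = 1, false = 0); B 0 is an unused dummy.
-- B_1 = 101,  B_{i+1} = B_i C_i  where C_i = B_i with its first i symbols removed.
B : ℕ → List Bool
B zero = []
B (suc zero) = true ∷ false ∷ true ∷ []
B (suc (suc i)) = B (suc i) ++ drop (suc i) (B (suc i))

-- k-th element (0-indexed) of a list, default false (never used below: |B_n| ≥ n + 2).
nth : List Bool → ℕ → Bool
nth [] _ = false
nth (x ∷ xs) zero = x
nth (x ∷ xs) (suc k) = nth xs k

-- w k = b_{k+1}  (0-indexed version of the infinite word b; B_{k+1} is a prefix of b
-- of length ≥ k+1, so its (k+1)-th symbol is b_{k+1}).
w : ℕ → Bool
w k = nth (B (suc k)) k

bit : Bool → ℕ
bit true = 1
bit false = 0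

a : ℕ → ℕ
a zero = 0
a (suc n) = a n Data.Nat.+ bit (w n)

half^ : ℕ → ℚ
half^ zero = 1ℚ
half^ (suc i) = ½ * half^ i

S : ℕ → ℚ
S zero = 0ℚ
S (suc m) = S m + (if w m then half^ (suc m) else 0ℚ)

ratio : ℕ → ℚ
ratio k = (+ a (suc k)) / (suc k)

-- Let L j = 2^j + j + 2 be the length of B_{j+1} and R m = 2^m (1 - S m), so that
-- α_m = 2 - 2 S m = 2 R m / 2^m.  As B_{j+2} ends with a copy of b_{j+2} … b_{L j}, the number of
-- ones is additive across blocks, a (L j + t) = a (L j) + a (j + 1 + t) - a (j + 1), and
-- a (L j) = 2 R j + a j.  Hence the scaled deviation 2^m (a x - α_m x) grows by only O(j) 2^m
-- from one block to the next, giving |a x - α_m x| = O((log x)²) for m ≥ log₂ x; going down to a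
-- smaller m costs at most 2 x, since 0 ≤ α_m - α_m' < 2^{1-m} for m ≤ m'.  Dividing by x,
-- a(x)/x - α_m → 0 as x and m tend to infinity together.

module Submission where

open import Defs

module Word where
  open import Data.Bool using (Bool)
  open import Data.List using (List; []; _∷_; _++_; drop; length)
  open import Data.List.Properties using (length-++; length-drop)
  open import Data.Nat
  open import Data.Nat.Properties
  open import Data.Nat.Tactic.RingSolver using (solve-∀)
  open import Data.Sum using (inj₁; inj₂)
  open import Relation.Binary.PropositionalEquality
  open ≡-Reasoning

  nth-++ˡ : ∀ (xs ys : List Bool) {k} → k < length xs → nth (xs ++ ys) k ≡ nth xs k
  nth-++ˡ (x ∷ xs) ys {zero}  _         = refl
  nth-++ˡ (x ∷ xs) ys {suc k} (s≤s k<∣xs∣) = nth-++ˡ xs ys k<∣xs∣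

  nth-++ʳ : ∀ (xs ys : List Bool) t → nth (xs ++ ys) (length xs + t) ≡ nth ys t
  nth-++ʳ []       ys t = refl
  nth-++ʳ (x ∷ xs) ys t = nth-++ʳ xs ys t

  nth-drop : ∀ i (xs : List Bool) t → nth (drop i xs) t ≡ nth xs (i + t)
  nth-drop zero    xs       t = refl
  nth-drop (suc i) []       t = refl
  nth-drop (suc i) (x ∷ xs) t = nth-drop i xs t

  L : ℕ → ℕ
  L j = 2 ^ j + j + 2

  L≡[1+j]+[1+2^j] : ∀ j → L j ≡ suc j + suc (2 ^ j)
  L≡[1+j]+[1+2^j] j = identity (2 ^ j) j
    where
    identity : ∀ p j → p + j + 2 ≡ suc j + suc p
    identity = solve-∀

  L-suc : ∀ j → L (suc j) ≡ L j + suc (2 ^ j)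
  L-suc j = identity (2 ^ j) j
    where
    identity : ∀ p j → 2 * p + suc j + 2 ≡ p + j + 2 + suc p
    identity = solve-∀

  L-mono : ∀ {i j} → i ≤ j → L i ≤ L j
  L-mono i≤j = +-monoˡ-≤ 2 (+-mono-≤ (^-monoʳ-≤ 2 i≤j) i≤j)

  n<L : ∀ n → n < L n
  n<L n = ≤-trans (m≤m+n (suc n) (suc (2 ^ n))) (≤-reflexive (sym (L≡[1+j]+[1+2^j] n)))

  length-B : ∀ j → length (B (suc j)) ≡ L j
  length-B zero    = refl
  length-B (suc j) = begin
    length (B (suc j) ++ drop (suc j) (B (suc j)))          ≡⟨ length-++ (B (suc j)) ⟩
    length (B (suc j)) + length (drop (suc j) (B (suc j)))  ≡⟨ cong (length (B (suc j)) +_) (length-drop (suc j) (B (suc j))) ⟩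
    length (B (suc j)) + (length (B (suc j)) ∸ suc j)       ≡⟨ cong (λ ℓ → ℓ + (ℓ ∸ suc j)) (length-B j) ⟩
    L j + (L j ∸ suc j)                                     ≡⟨ cong (λ ℓ → L j + (ℓ ∸ suc j)) (L≡[1+j]+[1+2^j] j) ⟩
    L j + (suc j + suc (2 ^ j) ∸ suc j)                     ≡⟨ cong (L j +_) (m+n∸m≡n (suc j) (suc (2 ^ j))) ⟩
    L j + suc (2 ^ j)                                       ≡⟨ sym (L-suc j) ⟩
    L (suc j)                                               ∎

  nth-B-stable : ∀ {i j k} → i ≤′ j → k < L i → nth (B (suc j)) k ≡ nth (B (suc i)) k
  nth-B-stable ≤′-refl                  _   = refl
  nth-B-stable {i} {suc j} (≤′-step i≤′j) k<L =
    trans (nth-++ˡ (B (suc j)) _ (subst (_ <_) (sym (length-B j)) (<-≤-trans k<L (L-mono (≤′⇒≤ i≤′j)))))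
          (nth-B-stable i≤′j k<L)

  nth-B≡w : ∀ j {k} → k < L j → nth (B (suc j)) k ≡ w k
  nth-B≡w j {k} k<L with ≤-total j k
  ... | inj₁ j≤k = sym (nth-B-stable (≤⇒≤′ j≤k) k<L)
  ... | inj₂ k≤j = nth-B-stable (≤⇒≤′ k≤j) (n<L k)

  w-selfsimilar : ∀ j t → t ≤ 2 ^ j → w (L j + t) ≡ w (suc j + t)
  w-selfsimilar j t t≤2^j = begin
    w (L j + t)                                        ≡⟨ sym (nth-B≡w (suc j) in-B[j+2]) ⟩
    nth (B (suc j) ++ C) (L j + t)                     ≡⟨ cong (λ ℓ → nth (B (suc j) ++ C) (ℓ + t)) (sym (length-B j)) ⟩
    nth (B (suc j) ++ C) (length (B (suc j)) + t)      ≡⟨ nth-++ʳ (B (suc j)) C t ⟩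
    nth C t                                            ≡⟨ nth-drop (suc j) (B (suc j)) t ⟩
    nth (B (suc j)) (suc j + t)                        ≡⟨ nth-B≡w j in-B[j+1] ⟩
    w (suc j + t)                                      ∎
    where
    C = drop (suc j) (B (suc j))
    in-B[j+2] : L j + t < L (suc j)
    in-B[j+2] = subst (L j + t <_) (sym (L-suc j)) (+-monoʳ-< (L j) (s≤s t≤2^j))
    in-B[j+1] : suc j + t < L j
    in-B[j+1] = subst (suc j + t <_) (sym (L≡[1+j]+[1+2^j] j)) (+-monoʳ-< (suc j) (s≤s t≤2^j))

module Ones where
  open import Data.Bool using (true; false)
  open import Data.Nat
  open import Data.Nat.Properties
  open import Data.Nat.Tactic.RingSolver using (solve-∀)
  open import Data.Product using (∃-syntax; _×_; _,_)
  open import Relation.Binary.PropositionalEquality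
  open Word

  bit≤1 : ∀ b → bit b ≤ 1
  bit≤1 true  = ≤-refl
  bit≤1 false = z≤n

  a≤n : ∀ n → a n ≤ n
  a≤n zero    = z≤n
  a≤n (suc n) = subst (a n + bit (w n) ≤_) (+-comm n 1) (+-mono-≤ (a≤n n) (bit≤1 (w n)))

  a-window : ∀ p q t → (∀ i → i < t → w (p + i) ≡ w (q + i)) →
             a (p + t) + a q ≡ a p + a (q + t)
  a-window p q zero    _    rewrite +-identityʳ p | +-identityʳ q = refl
  a-window p q (suc t) same = begin
    a (p + suc t) + a q                   ≡⟨ cong (λ x → a x + a q) (+-suc p t) ⟩
    a (p + t) + bit (w (p + t)) + a q     ≡⟨ cong (λ b → a (p + t) + bit b + a q) (same t ≤-refl) ⟩
    a (p + t) + bit (w (q + t)) + a q     ≡⟨ +-swap (a (p + t)) (bit (w (q + t))) (a q) ⟩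
    a (p + t) + a q + bit (w (q + t))     ≡⟨ cong (_+ bit (w (q + t))) (a-window p q t (λ i i<t → same i (m<n⇒m<1+n i<t))) ⟩
    a p + a (q + t) + bit (w (q + t))     ≡⟨ +-assoc (a p) (a (q + t)) _ ⟩
    a p + a (suc (q + t))                 ≡⟨ cong (λ x → a p + a x) (sym (+-suc q t)) ⟩
    a p + a (q + suc t)                   ∎
    where
    open ≡-Reasoning
    +-swap : ∀ x y z → x + y + z ≡ x + z + y
    +-swap = solve-∀

  a-shift : ∀ j t → t ≤ suc (2 ^ j) → a (L j + t) + a (suc j) ≡ a (L j) + a (suc j + t)
  a-shift j t t≤ = a-window (L j) (suc j) t (λ i i<t → w-selfsimilar j i (s≤s⁻¹ (<-≤-trans i<t t≤)))

  R : ℕ → ℕ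
  R zero    = 1
  R (suc m) = 2 * R m ∸ bit (w m)

  R-pos : ∀ m → 1 ≤ R m
  R-pos zero    = ≤-refl
  R-pos (suc m) = ∸-mono (*-monoʳ-≤ 2 (R-pos m)) (bit≤1 (w m))

  R-suc : ∀ m → R (suc m) + bit (w m) ≡ 2 * R m
  R-suc m = m∸n+n≡m (≤-trans (bit≤1 (w m)) (≤-trans (R-pos m) (m≤m+n (R m) (R m + 0))))

  R≤2^ : ∀ m → R m ≤ 2 ^ m
  R≤2^ zero    = ≤-refl
  R≤2^ (suc m) = begin
    R (suc m)                 ≤⟨ m≤m+n (R (suc m)) (bit (w m)) ⟩
    R (suc m) + bit (w m)     ≡⟨ R-suc m ⟩
    2 * R m                   ≤⟨ *-monoʳ-≤ 2 (R≤2^ m) ⟩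
    2 * 2 ^ m                 ∎
    where open ≤-Reasoning

  R-split : ∀ r j → ∃[ e ] (e < 2 ^ r × R (r + j) + e ≡ 2 ^ r * R j)
  R-split zero    j = 0 , z<s , trans (+-identityʳ (R j)) (sym (*-identityˡ (R j)))
  R-split (suc r) j with R-split r j
  ... | e , e<2^r , split = bit (w (r + j)) + 2 * e , bound , split′
    where
    bound : bit (w (r + j)) + 2 * e < 2 ^ suc r
    bound = begin-strict
      bit (w (r + j)) + 2 * e   ≤⟨ +-monoˡ-≤ (2 * e) (bit≤1 (w (r + j))) ⟩
      1 + 2 * e                 <⟨ ≤-reflexive (sym (*-suc 2 e)) ⟩
      2 * suc e                 ≤⟨ *-monoʳ-≤ 2 e<2^r ⟩
      2 ^ suc r                 ∎
      where open ≤-Reasoning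
    split′ : R (suc (r + j)) + (bit (w (r + j)) + 2 * e) ≡ 2 ^ suc r * R j
    split′ = begin
      R (suc (r + j)) + (bit (w (r + j)) + 2 * e)  ≡⟨ +-assoc (R (suc (r + j))) _ _ ⟨
      R (suc (r + j)) + bit (w (r + j)) + 2 * e    ≡⟨ cong (_+ 2 * e) (R-suc (r + j)) ⟩
      2 * R (r + j) + 2 * e                        ≡⟨ *-distribˡ-+ 2 (R (r + j)) e ⟨
      2 * (R (r + j) + e)                          ≡⟨ cong (2 *_) split ⟩
      2 * (2 ^ r * R j)                            ≡⟨ *-assoc 2 (2 ^ r) (R j) ⟨
      2 ^ suc r * R j                              ∎
      where open ≡-Reasoning

  -- Both sides satisfy f (j + 1) = 2 f j - a (j + 1), as B_{j+2} is B_{j+1} followed by B_{j+1}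
  -- without its first j + 1 symbols.
  a-L : ∀ j → a (L j) ≡ 2 * R j + a j
  a-L zero    = refl
  a-L (suc j) = +-cancelʳ-≡ (a (suc j)) _ _ (begin
    a (L (suc j)) + a (suc j)                      ≡⟨ cong (λ x → a x + a (suc j)) (L-suc j) ⟩
    a (L j + suc (2 ^ j)) + a (suc j)              ≡⟨ a-shift j (suc (2 ^ j)) ≤-refl ⟩
    a (L j) + a (suc j + suc (2 ^ j))              ≡⟨ cong (λ x → a (L j) + a x) (sym (L≡[1+j]+[1+2^j] j)) ⟩
    a (L j) + a (L j)                              ≡⟨ cong (λ x → x + x) (a-L j) ⟩
    (2 * R j + a j) + (2 * R j + a j)              ≡⟨ cong (λ x → (x + a j) + (x + a j)) (R-suc j) ⟨
    (R (suc j) + b + a j) + (R (suc j) + b + a j)  ≡⟨ regroup (R (suc j)) b (a j) ⟩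
    (2 * R (suc j) + a (suc j)) + a (suc j)        ∎)
    where
    open ≡-Reasoning
    b = bit (w j)
    regroup : ∀ r b x → (r + b + x) + (r + b + x) ≡ (2 * r + (x + b)) + (x + b)
    regroup = solve-∀

module Deviation where
  open import Data.Nat
  open import Data.Nat.Properties
  open import Data.Nat.Tactic.RingSolver using (solve-∀)
  open import Data.Integer as ℤ using (ℤ; +_; ∣_∣)
  import Data.Integer.Properties as ℤ
  import Data.Integer.Tactic.RingSolver as ℤ-Solver
  open import Data.Product using (_,_)
  open import Relation.Nullary using (yes; no)
  open import Relation.Binary.PropositionalEquality
  open Word
  open Ones

  ∣+m-+n∣≤o : ∀ {m n o} → m ≤ o → n ≤ o → ∣ + m ℤ.- + n ∣ ≤ o
  ∣+m-+n∣≤o {m} {n} {o} m≤o n≤o = begin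
    ∣ + m ℤ.- + n ∣  ≡⟨ cong ∣_∣ (ℤ.m-n≡m⊖n m n) ⟩
    ∣ m ℤ.⊖ n ∣      ≤⟨ ℤ.∣m⊝n∣≤m⊔n m n ⟩
    m ⊔ n            ≤⟨ ⊔-lub m≤o n≤o ⟩
    o                ∎
    where open ≤-Reasoning

  [+k+m]-[+k+n]≡+m-+n : ∀ k m n → + (k + m) ℤ.- + (k + n) ≡ + m ℤ.- + n
  [+k+m]-[+k+n]≡+m-+n k m n = begin
    + (k + m) ℤ.- + (k + n)  ≡⟨ ℤ.m-n≡m⊖n (k + m) (k + n) ⟩
    (k + m) ℤ.⊖ (k + n)      ≡⟨ ℤ.+-cancelˡ-⊖ k m n ⟩
    m ℤ.⊖ n                  ≡⟨ ℤ.m-n≡m⊖n m n ⟨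
    + m ℤ.- + n              ∎
    where open ≡-Reasoning

  ∣i∣≤∣j∣+∣k∣+∣l∣ : ∀ i j k l → i ℤ.+ l ≡ j ℤ.+ k → ∣ i ∣ ≤ ∣ j ∣ + ∣ k ∣ + ∣ l ∣
  ∣i∣≤∣j∣+∣k∣+∣l∣ i j k l i+l≡j+k = begin
    ∣ i ∣                  ≡⟨ cong ∣_∣ (trans (i≡[i+l]-l i l) (cong (ℤ._- l) i+l≡j+k)) ⟩
    ∣ j ℤ.+ k ℤ.- l ∣      ≤⟨ ℤ.∣i-j∣≤∣i∣+∣j∣ (j ℤ.+ k) l ⟩
    ∣ j ℤ.+ k ∣ + ∣ l ∣    ≤⟨ +-monoˡ-≤ ∣ l ∣ (ℤ.∣i+j∣≤∣i∣+∣j∣ j k) ⟩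
    ∣ j ∣ + ∣ k ∣ + ∣ l ∣  ∎
    where
    open ≤-Reasoning
    i≡[i+l]-l : ∀ i l → i ≡ i ℤ.+ l ℤ.- l
    i≡[i+l]-l = ℤ-Solver.solve-∀

  +k*[+m-+n]≡+[k*m]-+[k*n] : ∀ k m n → + k ℤ.* (+ m ℤ.- + n) ≡ + (k * m) ℤ.- + (k * n)
  +k*[+m-+n]≡+[k*m]-+[k*n] k m n rewrite ℤ.pos-* k m | ℤ.pos-* k n = distrib (+ k) (+ m) (+ n)
    where
    distrib : ∀ k m n → k ℤ.* (m ℤ.- n) ≡ k ℤ.* m ℤ.- k ℤ.* n
    distrib = ℤ-Solver.solve-∀

  +m-+[n+o]≡+m-+n-+o : ∀ m n o → + m ℤ.- + (n + o) ≡ + m ℤ.- + n ℤ.- + o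
  +m-+[n+o]≡+m-+n-+o m n o rewrite ℤ.pos-+ n o = regroup (+ m) (+ n) (+ o)
    where
    regroup : ∀ m n o → m ℤ.- (n ℤ.+ o) ≡ m ℤ.- n ℤ.- o
    regroup = ℤ-Solver.solve-∀

  -- dev m x = 2^m (a x - α_m x)
  dev : ℕ → ℕ → ℤ
  dev m x = + (2 ^ m * a x) ℤ.- + (2 * R m * x)

  dev-+ : ∀ m x y → dev m x ℤ.+ dev m y ≡ + (2 ^ m * (a x + a y)) ℤ.- + (2 * R m * (x + y))
  dev-+ m x y
    rewrite *-distribˡ-+ (2 ^ m) (a x) (a y) | *-distribˡ-+ (2 * R m) x y
          | ℤ.pos-+ (2 ^ m * a x) (2 ^ m * a y) | ℤ.pos-+ (2 * R m * x) (2 * R m * y)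
    = regroup (+ (2 ^ m * a x)) (+ (2 ^ m * a y)) (+ (2 * R m * x)) (+ (2 * R m * y))
    where
    regroup : ∀ u v s t → u ℤ.- s ℤ.+ (v ℤ.- t) ≡ u ℤ.+ v ℤ.- (s ℤ.+ t)
    regroup = ℤ-Solver.solve-∀

  dev-additive : ∀ m {x₁ x₂ x₃ x₄} → x₁ + x₂ ≡ x₃ + x₄ → a x₁ + a x₂ ≡ a x₃ + a x₄ →
                 dev m x₁ ℤ.+ dev m x₂ ≡ dev m x₃ ℤ.+ dev m x₄
  dev-additive m {x₁} {x₂} {x₃} {x₄} sizes ones = begin
    dev m x₁ ℤ.+ dev m x₂                                          ≡⟨ dev-+ m x₁ x₂ ⟩
    + (2 ^ m * (a x₁ + a x₂)) ℤ.- + (2 * R m * (x₁ + x₂))          ≡⟨ cong₂ (λ A X → + (2 ^ m * A) ℤ.- + (2 * R m * X)) ones sizes ⟩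
    + (2 ^ m * (a x₃ + a x₄)) ℤ.- + (2 * R m * (x₃ + x₄))          ≡⟨ dev-+ m x₃ x₄ ⟨
    dev m x₃ ℤ.+ dev m x₄                                          ∎
    where open ≡-Reasoning

  ∣dev∣≤ : ∀ m x → ∣ dev m x ∣ ≤ 2 ^ m * (2 * x)
  ∣dev∣≤ m x = ∣+m-+n∣≤o (*-monoʳ-≤ (2 ^ m) (≤-trans (a≤n x) (m≤m+n x (x + 0))))
                         (≤-trans (*-monoˡ-≤ x (*-monoʳ-≤ 2 (R≤2^ m))) (≤-reflexive (swap (2 ^ m) x)))
    where
    swap : ∀ y x → 2 * y * x ≡ y * (2 * x)
    swap = solve-∀

  dev-L≡ : ∀ r j {e} → R (r + j) + e ≡ 2 ^ r * R j →
           dev (r + j) (L j) ≡ + (2 * 2 ^ j * e + 2 ^ (r + j) * a j) ℤ.- + (2 * R (r + j) * (j + 2))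
  dev-L≡ r j {e} split = begin
    dev (r + j) (L j)          ≡⟨ cong₂ (λ A X → + A ℤ.- + X) ones size ⟩
    + (K + P) ℤ.- + (K + N)    ≡⟨ [+k+m]-[+k+n]≡+m-+n K P N ⟩
    + P ℤ.- + N                ∎
    where
    open ≡-Reasoning
    X = 2 ^ j
    Y = 2 ^ (r + j)
    ρ = R (r + j)
    K = 2 * X * ρ
    P = 2 * X * e + Y * a j
    N = 2 * ρ * (j + 2)
    ones : Y * a (L j) ≡ K + P
    ones = begin
      Y * a (L j)                              ≡⟨ cong₂ _*_ (^-distribˡ-+-* 2 r j) (a-L j) ⟩
      2 ^ r * X * (2 * R j + a j)              ≡⟨ expand (2 ^ r) X (R j) (a j) ⟩
      2 * X * (2 ^ r * R j) + 2 ^ r * X * a j  ≡⟨ cong₂ (λ s y → 2 * X * s + y * a j) split (^-distribˡ-+-* 2 r j) ⟨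
      2 * X * (ρ + e) + Y * a j                ≡⟨ regroup X ρ e (Y * a j) ⟩
      K + P                                    ∎
      where
      expand : ∀ z x ρ α → z * x * (2 * ρ + α) ≡ 2 * x * (z * ρ) + z * x * α
      expand = solve-∀
      regroup : ∀ x ρ e y → 2 * x * (ρ + e) + y ≡ 2 * x * ρ + (2 * x * e + y)
      regroup = solve-∀
    size : 2 * ρ * L j ≡ K + N
    size = expand X ρ j
      where
      expand : ∀ x ρ j → 2 * ρ * (x + j + 2) ≡ 2 * x * ρ + 2 * ρ * (j + 2)
      expand = solve-∀

  ∣dev-L∣≤ : ∀ r j → ∣ dev (r + j) (L j) ∣ ≤ 2 ^ (r + j) * (2 * j + 4)
  ∣dev-L∣≤ r j with R-split r j
  ... | e , e<2^r , split = begin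
    ∣ dev (r + j) (L j) ∣                                       ≡⟨ cong ∣_∣ (dev-L≡ r j split) ⟩
    ∣ + (2 * X * e + Y * a j) ℤ.- + (2 * R (r + j) * (j + 2)) ∣  ≤⟨ ∣+m-+n∣≤o ones≤ size≤ ⟩
    Y * (2 * j + 4)                                             ∎
    where
    open ≤-Reasoning
    X = 2 ^ j
    Y = 2 ^ (r + j)
    Y≡ : Y ≡ 2 ^ r * X
    Y≡ = ^-distribˡ-+-* 2 r j
    ones≤ : 2 * X * e + Y * a j ≤ Y * (2 * j + 4)
    ones≤ = begin
      2 * X * e + Y * a j            ≤⟨ +-mono-≤ (*-monoʳ-≤ (2 * X) (<⇒≤ e<2^r)) (*-monoʳ-≤ Y (a≤n j)) ⟩
      2 * X * 2 ^ r + Y * j          ≡⟨ cong (λ y → 2 * X * 2 ^ r + y * j) Y≡ ⟩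
      2 * X * 2 ^ r + 2 ^ r * X * j  ≡⟨ collect X (2 ^ r) j ⟩
      2 ^ r * X * (j + 2)            ≡⟨ cong (_* (j + 2)) Y≡ ⟨
      Y * (j + 2)                    ≤⟨ *-monoʳ-≤ Y (+-mono-≤ (m≤m+n j (j + 0)) (m≤m+n 2 2)) ⟩
      Y * (2 * j + 4)                ∎
      where
      collect : ∀ x z j → 2 * x * z + z * x * j ≡ z * x * (j + 2)
      collect = solve-∀
    size≤ : 2 * R (r + j) * (j + 2) ≤ Y * (2 * j + 4)
    size≤ = begin
      2 * R (r + j) * (j + 2)        ≤⟨ *-monoˡ-≤ (j + 2) (*-monoʳ-≤ 2 (R≤2^ (r + j))) ⟩
      2 * Y * (j + 2)                ≡⟨ reassoc Y j ⟩
      Y * (2 * j + 4)                ∎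
      where
      reassoc : ∀ y j → 2 * y * (j + 2) ≡ y * (2 * j + 4)
      reassoc = solve-∀

  C : ℕ → ℕ
  C j = 6 * (suc j * suc j)

  C-step : ∀ j → (2 * j + 4) + C j + 2 * suc j ≤ C (suc j)
  C-step j = ≤-trans (m≤m+n _ (8 * j + 12)) (≤-reflexive (expand j))
    where
    expand : ∀ j → (2 * j + 4) + 6 * (suc j * suc j) + 2 * suc j + (8 * j + 12) ≡ 6 * (suc (suc j) * suc (suc j))
    expand = solve-∀

  C-mono : ∀ j → C j ≤ C (suc j)
  C-mono j = ≤-trans (≤-trans (m≤n+m (C j) (2 * j + 4)) (m≤m+n _ (2 * suc j))) (C-step j)

  ∣dev-L+t∣≤ : ∀ m j → j ≤ m → (∀ y → y ≤ L j → ∣ dev m y ∣ ≤ 2 ^ m * C j) →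
               ∀ t → t ≤ suc (2 ^ j) → ∣ dev m (L j + t) ∣ ≤ 2 ^ m * C (suc j)
  ∣dev-L+t∣≤ m j j≤m below t t≤ = begin
    ∣ dev m (L j + t) ∣
      ≤⟨ ∣i∣≤∣j∣+∣k∣+∣l∣ (dev m (L j + t)) (dev m (L j)) (dev m y) (dev m (suc j)) additive ⟩
    ∣ dev m (L j) ∣ + ∣ dev m y ∣ + ∣ dev m (suc j) ∣      ≤⟨ +-mono-≤ (+-mono-≤ dev-L (below y y≤L)) (∣dev∣≤ m (suc j)) ⟩
    Y * (2 * j + 4) + Y * C j + Y * (2 * suc j)            ≡⟨ factor Y (2 * j + 4) (C j) (2 * suc j) ⟩
    Y * ((2 * j + 4) + C j + 2 * suc j)                    ≤⟨ *-monoʳ-≤ Y (C-step j) ⟩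
    Y * C (suc j)                                          ∎
    where
    open ≤-Reasoning
    Y = 2 ^ m
    y = suc j + t
    sizes : L j + t + suc j ≡ L j + y
    sizes = trans (+-assoc (L j) t (suc j)) (cong (λ s → L j + s) (+-comm t (suc j)))
    additive : dev m (L j + t) ℤ.+ dev m (suc j) ≡ dev m (L j) ℤ.+ dev m y
    additive = dev-additive m sizes (a-shift j t t≤)
    y≤L : y ≤ L j
    y≤L = ≤-trans (+-monoʳ-≤ (suc j) t≤) (≤-reflexive (sym (L≡[1+j]+[1+2^j] j)))
    dev-L : ∣ dev m (L j) ∣ ≤ Y * (2 * j + 4)
    dev-L = subst (λ k → ∣ dev k (L j) ∣ ≤ 2 ^ k * (2 * j + 4)) (m∸n+n≡m j≤m) (∣dev-L∣≤ (m ∸ j) j)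
    factor : ∀ y p q r → y * p + y * q + y * r ≡ y * (p + q + r)
    factor = solve-∀

  ∣dev∣≤C : ∀ m j → j ≤ suc m → ∀ x → x ≤ L j → ∣ dev m x ∣ ≤ 2 ^ m * C j
  ∣dev∣≤C m zero    _         x x≤3 = ≤-trans (∣dev∣≤ m x) (*-monoʳ-≤ (2 ^ m) (*-monoʳ-≤ 2 x≤3))
  ∣dev∣≤C m (suc j) (s≤s j≤m) x x≤L[j+1] with x ≤? L j
  ... | yes x≤L[j] = ≤-trans (∣dev∣≤C m j (m≤n⇒m≤1+n j≤m) x x≤L[j]) (*-monoʳ-≤ (2 ^ m) (C-mono j))
  ... | no  x≰L[j] = subst (λ z → ∣ dev m z ∣ ≤ 2 ^ m * C (suc j)) (m+[n∸m]≡n (<⇒≤ (≰⇒> x≰L[j])))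
                       (∣dev-L+t∣≤ m j j≤m (∣dev∣≤C m j (m≤n⇒m≤1+n j≤m)) (x ∸ L j) t≤)
    where
    t≤ : x ∸ L j ≤ suc (2 ^ j)
    t≤ = ≤-trans (∸-monoˡ-≤ (L j) (≤-trans x≤L[j+1] (≤-reflexive (L-suc j))))
                 (≤-reflexive (m+n∸m≡n (L j) (suc (2 ^ j))))

  dev-rescale : ∀ r m x {e} → R (r + m) + e ≡ 2 ^ r * R m →
                + (2 ^ r) ℤ.* dev m x ≡ dev (r + m) x ℤ.- + (2 * e * x)
  dev-rescale r m x {e} split = begin
    + Z ℤ.* dev m x                                       ≡⟨ +k*[+m-+n]≡+[k*m]-+[k*n] Z (2 ^ m * a x) (2 * R m * x) ⟩
    + (Z * (2 ^ m * a x)) ℤ.- + (Z * (2 * R m * x))       ≡⟨ cong₂ (λ A X → + A ℤ.- + X) ones size ⟩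
    + (2 ^ (r + m) * a x) ℤ.- + (2 * ρ * x + 2 * e * x)   ≡⟨ +m-+[n+o]≡+m-+n-+o (2 ^ (r + m) * a x) (2 * ρ * x) (2 * e * x) ⟩
    dev (r + m) x ℤ.- + (2 * e * x)                       ∎
    where
    open ≡-Reasoning
    Z = 2 ^ r
    ρ = R (r + m)
    ones : Z * (2 ^ m * a x) ≡ 2 ^ (r + m) * a x
    ones = trans (sym (*-assoc Z (2 ^ m) (a x))) (cong (_* a x) (sym (^-distribˡ-+-* 2 r m)))
    size : Z * (2 * R m * x) ≡ 2 * ρ * x + 2 * e * x
    size = begin
      Z * (2 * R m * x)          ≡⟨ reassoc Z (R m) x ⟩
      2 * (Z * R m) * x          ≡⟨ cong (λ s → 2 * s * x) split ⟨
      2 * (ρ + e) * x            ≡⟨ expand ρ e x ⟩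
      2 * ρ * x + 2 * e * x      ∎
      where
      reassoc : ∀ z r x → z * (2 * r * x) ≡ 2 * (z * r) * x
      reassoc = solve-∀
      expand : ∀ ρ e x → 2 * (ρ + e) * x ≡ 2 * ρ * x + 2 * e * x
      expand = solve-∀

  ∣dev∣-descend : ∀ r m x c → ∣ dev (r + m) x ∣ ≤ 2 ^ (r + m) * c → ∣ dev m x ∣ ≤ 2 ^ m * c + 2 * x
  ∣dev∣-descend r m x c bound with R-split r m
  ... | e , e<2^r , split = *-cancelˡ-≤ Z {{m^n≢0 2 r}} (begin
    Z * ∣ dev m x ∣                       ≡⟨ ℤ.abs-* (+ Z) (dev m x) ⟨
    ∣ + Z ℤ.* dev m x ∣                   ≡⟨ cong ∣_∣ (dev-rescale r m x split) ⟩
    ∣ dev (r + m) x ℤ.- + (2 * e * x) ∣   ≤⟨ ℤ.∣i-j∣≤∣i∣+∣j∣ (dev (r + m) x) (+ (2 * e * x)) ⟩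
    ∣ dev (r + m) x ∣ + 2 * e * x         ≤⟨ +-mono-≤ bound (*-monoˡ-≤ x (*-monoʳ-≤ 2 (<⇒≤ e<2^r))) ⟩
    2 ^ (r + m) * c + 2 * Z * x           ≡⟨ cong (λ y → y * c + 2 * Z * x) (^-distribˡ-+-* 2 r m) ⟩
    Z * 2 ^ m * c + 2 * Z * x             ≡⟨ factor Z (2 ^ m) c x ⟩
    Z * (2 ^ m * c + 2 * x)               ∎)
    where
    open ≤-Reasoning
    Z = 2 ^ r
    factor : ∀ z y c x → z * y * c + 2 * z * x ≡ z * (y * c + 2 * x)
    factor = solve-∀

module Asymptotics where
  open import Data.Empty using (⊥-elim)
  open import Data.Nat
  open import Data.Nat.Properties
  open import Data.Nat.Tactic.RingSolver using (solve-∀)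
  open import Data.Integer using (∣_∣)
  open import Data.Product using (∃-syntax; _×_; _,_)
  open import Relation.Binary.PropositionalEquality
  open import Relation.Nullary using (yes; no)
  open Word
  open Deviation

  n<2^n : ∀ n → n < 2 ^ n
  n<2^n zero    = z<s
  n<2^n (suc n) = +-mono-≤ (m^n>0 2 n) (≤-trans (n<2^n n) (m≤m+n (2 ^ n) 0))

  [1+k]³≤8*2^k : ∀ k → suc k * suc k * suc k ≤ 8 * 2 ^ k
  [1+k]³≤8*2^k 0 = ≤ᵇ⇒≤ 1 8 _
  [1+k]³≤8*2^k 1 = ≤ᵇ⇒≤ 8 16 _
  [1+k]³≤8*2^k 2 = ≤ᵇ⇒≤ 27 32 _
  [1+k]³≤8*2^k 3 = ≤ᵇ⇒≤ 64 64 _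
  [1+k]³≤8*2^k (suc (suc (suc (suc l)))) = begin
    (5 + l) * (5 + l) * (5 + l)              ≤⟨ m≤m+n _ (l * l * l + 9 * (l * l) + 21 * l + 3) ⟩
    (5 + l) * (5 + l) * (5 + l) + (l * l * l + 9 * (l * l) + 21 * l + 3)
                                             ≡⟨ cube l ⟩
    2 * ((4 + l) * (4 + l) * (4 + l))        ≤⟨ *-monoʳ-≤ 2 ([1+k]³≤8*2^k (suc (suc (suc l)))) ⟩
    2 * (8 * 2 ^ (3 + l))                    ≡⟨ *-comm-8 (2 ^ (3 + l)) ⟩
    8 * 2 ^ (4 + l)                          ∎
    where
    open ≤-Reasoning
    cube : ∀ l → (5 + l) * (5 + l) * (5 + l) + (l * l * l + 9 * (l * l) + 21 * l + 3) ≡ 2 * ((4 + l) * (4 + l) * (4 + l))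
    cube = solve-∀
    *-comm-8 : ∀ p → 2 * (8 * p) ≡ 8 * (2 * p)
    *-comm-8 = solve-∀

  K*[2+k]²≤2^k : ∀ K k → 16 * K ≤ k → K * ((2 + k) * (2 + k)) ≤ 2 ^ k
  K*[2+k]²≤2^k K k 16K≤k = *-cancelˡ-≤ (2 + k) (begin
    (2 + k) * (K * ((2 + k) * (2 + k)))   ≡⟨ reassoc K k ⟩
    K * ((2 + k) * (2 + k) * (2 + k))     ≤⟨ *-monoʳ-≤ K ([1+k]³≤8*2^k (suc k)) ⟩
    K * (8 * (2 * 2 ^ k))                 ≡⟨ regroup K (2 ^ k) ⟩
    16 * K * 2 ^ k                        ≤⟨ *-monoˡ-≤ (2 ^ k) (≤-trans 16K≤k (m≤n+m k 2)) ⟩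
    (2 + k) * 2 ^ k                       ∎)
    where
    open ≤-Reasoning
    reassoc : ∀ K k → (2 + k) * (K * ((2 + k) * (2 + k))) ≡ K * ((2 + k) * (2 + k) * (2 + k))
    reassoc = solve-∀
    regroup : ∀ K p → K * (8 * (2 * p)) ≡ 16 * K * p
    regroup = solve-∀

  locate : ∀ (f : ℕ → ℕ) {x} n → f 0 < x → x ≤ f n → ∃[ k ] (f k < x × x ≤ f (suc k))
  locate f     zero    f0<x x≤f0   = ⊥-elim (≤⇒≯ x≤f0 f0<x)
  locate f {x} (suc n) f0<x x≤f[n+1] with x ≤? f n
  ... | yes x≤f[n] = locate f n f0<x x≤f[n]
  ... | no  x≰f[n] = n , ≰⇒> x≰f[n] , x≤f[n+1]

  q*[Yc+2x]<Yx : ∀ q Y c x .{{_ : NonZero Y}} → 2 * q * c < x → 4 * q ≤ Y → q * (Y * c + 2 * x) < Y * x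
  q*[Yc+2x]<Yx q Y c x 2qc<x 4q≤Y = *-cancelˡ-< 2 _ _ (begin-strict
    2 * (q * (Y * c + 2 * x))      ≡⟨ expand q Y c x ⟩
    Y * (2 * q * c) + 4 * q * x    <⟨ +-mono-<-≤ (*-monoʳ-< Y 2qc<x) (*-monoˡ-≤ x 4q≤Y) ⟩
    Y * x + Y * x                  ≡⟨ double (Y * x) ⟩
    2 * (Y * x)                    ∎)
    where
    open ≤-Reasoning
    expand : ∀ q Y c x → 2 * (q * (Y * c + 2 * x)) ≡ Y * (2 * q * c) + 4 * q * x
    expand = solve-∀
    double : ∀ z → z + z ≡ 2 * z
    double = solve-∀

  q*∣dev∣<2^m*x : ∀ q → ∃[ N ] (∀ x m → N < x → N ≤ m → q * ∣ dev m x ∣ < 2 ^ m * x)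
  q*∣dev∣<2^m*x q = N , bound
    where
    I = 16 * (12 * q)
    N = L I + 4 * q
    L[I]<_ : ∀ {x} → N < x → L I < x
    L[I]< N<x = ≤-<-trans (m≤m+n (L I) (4 * q)) N<x
    bound : ∀ x m → N < x → N ≤ m → q * ∣ dev m x ∣ < 2 ^ m * x
    bound x m N<x N≤m with locate L x (≤-<-trans (L-mono {j = I} z≤n) (L[I]< N<x)) (<⇒≤ (n<L x))
    ... | k , L[k]<x , x≤L[k+1] =
      ≤-<-trans (*-monoʳ-≤ q dev-bound) (q*[Yc+2x]<Yx q (2 ^ m) (C (suc k)) x {{m^n≢0 2 m}} 2qC<x 4q≤2^m)
      where
      I≤k : I ≤ k
      I≤k with I ≤? k
      ... | yes I≤k = I≤k
      ... | no  I≰k = ⊥-elim (≤⇒≯ (≤-trans x≤L[k+1] (L-mono (≰⇒> I≰k))) (L[I]< N<x))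
      k≤x+m : k ≤ x + m
      k≤x+m = ≤-trans (<⇒≤ (<-trans (n<L k) L[k]<x)) (m≤m+n x m)
      dev-bound : ∣ dev m x ∣ ≤ 2 ^ m * C (suc k) + 2 * x
      dev-bound = ∣dev∣-descend x m x (C (suc k)) (∣dev∣≤C (x + m) (suc k) (s≤s k≤x+m) x x≤L[k+1])
      2qC<x : 2 * q * C (suc k) < x
      2qC<x = begin-strict
        2 * q * C (suc k)               ≡⟨ regroup q k ⟩
        12 * q * ((2 + k) * (2 + k))    ≤⟨ K*[2+k]²≤2^k (12 * q) k I≤k ⟩
        2 ^ k                           ≤⟨ ≤-trans (m≤m+n (2 ^ k) k) (m≤m+n (2 ^ k + k) 2) ⟩
        L k                             <⟨ L[k]<x ⟩
        x                               ∎
        where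
        open ≤-Reasoning
        regroup : ∀ q k → 2 * q * (6 * ((2 + k) * (2 + k))) ≡ 12 * q * ((2 + k) * (2 + k))
        regroup = solve-∀
      4q≤2^m : 4 * q ≤ 2 ^ m
      4q≤2^m = ≤-trans (m≤n+m (4 * q) (L I)) (≤-trans N≤m (<⇒≤ (n<2^n m)))

open import Data.Bool using (true; false; if_then_else_)
open import Data.Nat using (ℕ; suc; _≤_)
import Data.Nat as ℕ
import Data.Nat.Properties as ℕ
open import Data.Nat.Coprimality using (Coprime)
open import Data.Product using (∃-syntax; _,_)
open import Data.Integer using (+_)
import Data.Integer as ℤ
import Data.Integer.Properties as ℤ
import Data.Integer.Tactic.RingSolver as ℤ-Solver
open import Data.Rational using (ℚ; 0ℚ; _<_; _-_; _*_; ∣_∣; _/_)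
import Data.Rational as ℚ
import Data.Rational.Properties as ℚ
open import Data.Rational.Unnormalised using (mkℚᵘ; _≃_; *≡*; *<*)
import Data.Rational.Unnormalised as ℚᵘ
import Data.Rational.Unnormalised.Properties as ℚᵘ
open import Relation.Binary.PropositionalEquality using (_≡_; refl; sym; trans; cong; cong₂; subst₂)
open Ones using (R; R-suc)
open Deviation using (dev)
open Asymptotics using (q*∣dev∣<2^m*x)

error : ℕ → ℕ → ℚ
error n m = ratio n - ((+ 2 / 1) - (+ 2 / 1) * S m)

-- P k = 2^k - 1, so that mkℚᵘ i (P k) is i / 2^k.
P : ℕ → ℕ
P k = ℕ.pred (2 ℕ.^ k)

suc-P : ∀ k → suc (P k) ≡ 2 ℕ.^ k
suc-P k = ℕ.suc-pred (2 ℕ.^ k) {{ℕ.m^n≢0 2 k}}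

toℚᵘ-/ : ∀ i n → ℚ.toℚᵘ (i / suc n) ≃ mkℚᵘ i n
toℚᵘ-/ i n = ℚ.toℚᵘ-fromℚᵘ (mkℚᵘ i n)

suc-P-suc : ∀ k → + suc (P (suc k)) ≡ + 2 ℤ.* + suc (P k)
suc-P-suc k = cong +_ (trans (suc-P (suc k)) (cong (2 ℕ.*_) (sym (suc-P k))))

half^≃ : ∀ k → ℚ.toℚᵘ (half^ k) ≃ mkℚᵘ (+ 1) (P k)
half^≃ ℕ.zero  = ℚᵘ.≃-refl
half^≃ (suc k) = begin-equality
  ℚ.toℚᵘ (ℚ.½ * half^ k)                   ≃⟨ ℚ.toℚᵘ-homo-* ℚ.½ (half^ k) ⟩
  ℚ.toℚᵘ ℚ.½ ℚᵘ.* ℚ.toℚᵘ (half^ k)         ≃⟨ ℚᵘ.*-congˡ {ℚ.toℚᵘ ℚ.½} (half^≃ k) ⟩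
  mkℚᵘ (+ 1) 1 ℚᵘ.* mkℚᵘ (+ 1) (P k)      ≃⟨ *≡* (halve {+ suc (P k)} (suc-P-suc k)) ⟩
  mkℚᵘ (+ 1) (P (suc k))                  ∎
  where
  open ℚᵘ.≤-Reasoning
  halve : ∀ {Y Y′} → Y′ ≡ + 2 ℤ.* Y → (+ 1 ℤ.* + 1) ℤ.* Y′ ≡ + 1 ℤ.* (+ 2 ℤ.* Y)
  halve refl = refl

bit-term≃ : ∀ m → ℚ.toℚᵘ (if w m then half^ (suc m) else 0ℚ) ≃ mkℚᵘ (+ bit (w m)) (P (suc m))
bit-term≃ m with w m
... | true  = half^≃ (suc m)
... | false = *≡* refl

S≃ : ∀ m → ℚ.toℚᵘ (S m) ≃ mkℚᵘ (+ suc (P m) ℤ.- + R m) (P m)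
S≃ ℕ.zero  = *≡* refl
S≃ (suc m) = begin-equality
  ℚ.toℚᵘ (S m ℚ.+ term)                                ≃⟨ ℚ.toℚᵘ-homo-+ (S m) term ⟩
  ℚ.toℚᵘ (S m) ℚᵘ.+ ℚ.toℚᵘ term                        ≃⟨ ℚᵘ.+-cong (S≃ m) (bit-term≃ m) ⟩
  mkℚᵘ (Y ℤ.- ρ) (P m) ℚᵘ.+ mkℚᵘ b (P (suc m))         ≃⟨ *≡* (carry {Y} {ρ = ρ} {b = b} (suc-P-suc m) R-suc′) ⟩
  mkℚᵘ (+ suc (P (suc m)) ℤ.- + R (suc m)) (P (suc m))  ∎
  where
  open ℚᵘ.≤-Reasoning
  term = if w m then half^ (suc m) else 0ℚ
  Y = + suc (P m)
  ρ = + R m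
  b = + bit (w m)
  R-suc′ : + R (suc m) ≡ + 2 ℤ.* ρ ℤ.- b
  R-suc′ = trans (i≡[i+j]-j (+ R (suc m)) b)
                 (cong (ℤ._- b) (trans (sym (ℤ.pos-+ (R (suc m)) (bit (w m))))
                                       (trans (cong +_ (R-suc m)) (ℤ.pos-* 2 (R m)))))
    where
    i≡[i+j]-j : ∀ i j → i ≡ i ℤ.+ j ℤ.- j
    i≡[i+j]-j = ℤ-Solver.solve-∀
  carry : ∀ {Y Y′ ρ ρ′ b} → Y′ ≡ + 2 ℤ.* Y → ρ′ ≡ + 2 ℤ.* ρ ℤ.- b →
          ((Y ℤ.- ρ) ℤ.* Y′ ℤ.+ b ℤ.* Y) ℤ.* Y′ ≡ (Y′ ℤ.- ρ′) ℤ.* (Y ℤ.* Y′)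
  carry {Y} {ρ = ρ} {b = b} refl refl = identity Y ρ b
    where
    identity : ∀ Y ρ b → ((Y ℤ.- ρ) ℤ.* (+ 2 ℤ.* Y) ℤ.+ b ℤ.* Y) ℤ.* (+ 2 ℤ.* Y)
                         ≡ (+ 2 ℤ.* Y ℤ.- (+ 2 ℤ.* ρ ℤ.- b)) ℤ.* (Y ℤ.* (+ 2 ℤ.* Y))
    identity = ℤ-Solver.solve-∀

dev≡ : ∀ m x → dev m x ≡ + suc (P m) ℤ.* + a x ℤ.- + 2 ℤ.* + R m ℤ.* + x
dev≡ m x = cong₂ ℤ._-_
  (trans (cong (λ y → + (y ℕ.* a x)) (sym (suc-P m))) (ℤ.pos-* (suc (P m)) (a x)))
  (trans (ℤ.pos-* (2 ℕ.* R m) x) (cong (ℤ._* + x) (ℤ.pos-* 2 (R m))))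

two≃ : ℚ.toℚᵘ (+ 2 / 1) ≃ mkℚᵘ (+ 2) 0
two≃ = toℚᵘ-/ (+ 2) 0

error≃ : ∀ n m → ℚ.toℚᵘ (error n m) ≃ mkℚᵘ (dev m (suc n)) (ℕ.pred (suc n ℕ.* suc (P m)))
error≃ n m = begin-equality
  ℚ.toℚᵘ (ratio n - T)                                  ≃⟨ ℚ.toℚᵘ-homo-+ (ratio n) (ℚ.- T) ⟩
  ℚ.toℚᵘ (ratio n) ℚᵘ.+ ℚ.toℚᵘ (ℚ.- T)                   ≃⟨ ℚᵘ.+-cong (toℚᵘ-/ (+ a (suc n)) n) (ℚ.toℚᵘ-homo‿- T) ⟩
  mkℚᵘ A n ℚᵘ.- ℚ.toℚᵘ T                                 ≃⟨ ℚᵘ.+-congʳ (mkℚᵘ A n) (ℚᵘ.-‿cong T≃) ⟩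
  mkℚᵘ A n ℚᵘ.- (two ℚᵘ.- two ℚᵘ.* mkℚᵘ (Y ℤ.- ρ) (P m))
    ≃⟨ *≡* (trans (cross A X Y ρ) (cong (ℤ._* (X ℤ.* (+ 1 ℤ.* (+ 1 ℤ.* Y)))) (sym (dev≡ m (suc n))))) ⟩
  mkℚᵘ (dev m (suc n)) (ℕ.pred (suc n ℕ.* suc (P m)))   ∎
  where
  open ℚᵘ.≤-Reasoning
  T = (+ 2 / 1) - (+ 2 / 1) * S m
  A = + a (suc n)
  X = + suc n
  Y = + suc (P m)
  ρ = + R m
  two = mkℚᵘ (+ 2) 0
  T≃ : ℚ.toℚᵘ T ≃ two ℚᵘ.- two ℚᵘ.* mkℚᵘ (Y ℤ.- ρ) (P m)
  T≃ = ℚᵘ.≃-trans (ℚ.toℚᵘ-homo-+ (+ 2 / 1) (ℚ.- ((+ 2 / 1) * S m)))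
         (ℚᵘ.+-cong two≃ (ℚᵘ.≃-trans (ℚ.toℚᵘ-homo‿- ((+ 2 / 1) * S m))
           (ℚᵘ.-‿cong (ℚᵘ.≃-trans (ℚ.toℚᵘ-homo-* (+ 2 / 1) (S m)) (ℚᵘ.*-cong two≃ (S≃ m))))))
  -- The left-hand side is the cross-multiplied form to which the ℚᵘ expression above reduces.
  cross : ∀ A X Y ρ →
          (A ℤ.* (+ 1 ℤ.* (+ 1 ℤ.* Y)) ℤ.+ (ℤ.- (+ 2 ℤ.* (+ 1 ℤ.* Y) ℤ.+ (ℤ.- (+ 2 ℤ.* (Y ℤ.- ρ))) ℤ.* + 1)) ℤ.* X)
            ℤ.* (X ℤ.* Y)
          ≡ (Y ℤ.* A ℤ.- + 2 ℤ.* ρ ℤ.* X) ℤ.* (X ℤ.* (+ 1 ℤ.* (+ 1 ℤ.* Y)))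
  cross = ℤ-Solver.solve-∀

∣error∣<ε : ∀ n m p q .{c : Coprime (suc p) (suc q)} →
            suc q ℕ.* ℤ.∣ dev m (suc n) ∣ ℕ.< 2 ℕ.^ m ℕ.* suc n → ∣ error n m ∣ < ℚ.mkℚ ℤ.+[1+ p ] q c
∣error∣<ε n m p q small = ℚ.toℚᵘ-cancel-< (ℚᵘ.<-respˡ-≃ (ℚᵘ.≃-sym ∣error∣≃) (*<* cross))
  where
  δ = ℤ.∣ dev m (suc n) ∣
  D = suc n ℕ.* suc (P m)
  ∣error∣≃ : ℚ.toℚᵘ ∣ error n m ∣ ≃ ℚᵘ.∣ mkℚᵘ (dev m (suc n)) (ℕ.pred D) ∣
  ∣error∣≃ = ℚᵘ.≃-trans (ℚ.toℚᵘ-homo-∣-∣ (error n m)) (ℚᵘ.∣-∣-cong (error≃ n m))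
  cross : + δ ℤ.* + suc q ℤ.< ℤ.+[1+ p ] ℤ.* + D
  cross = subst₂ ℤ._<_ (ℤ.pos-* δ (suc q)) (ℤ.pos-* (suc p) D) (ℤ.+<+ (begin-strict
    δ ℕ.* suc q               ≡⟨ ℕ.*-comm δ (suc q) ⟩
    suc q ℕ.* δ               <⟨ small ⟩
    2 ℕ.^ m ℕ.* suc n         ≡⟨ cong (ℕ._* suc n) (sym (suc-P m)) ⟩
    suc (P m) ℕ.* suc n       ≡⟨ ℕ.*-comm (suc (P m)) (suc n) ⟩
    D                         ≤⟨ ℕ.m≤m+n D (p ℕ.* D) ⟩
    suc p ℕ.* D               ∎))
    where open ℕ.≤-Reasoning

theorem10 : (ε : ℚ) → 0ℚ < ε →
            ∃[ N ] ((n m : ℕ) → N ≤ n → N ≤ m →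
              ∣ ratio n - ((+ 2 / 1) - (+ 2 / 1) * S m) ∣ < ε)
theorem10 (ℚ.mkℚ ℤ.+[1+ p ] q _) _ =
  let N , small = q*∣dev∣<2^m*x (suc q) in
  N , λ n m N≤n N≤m → ∣error∣<ε n m p q (small (suc n) m (ℕ.s≤s N≤n) N≤m)
theorem10 (ℚ.mkℚ (+ 0)        _ _) (ℚ.*<* (ℤ.+<+ ()))
theorem10 (ℚ.mkℚ ℤ.-[1+ _ ]   _ _) (ℚ.*<* ())
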